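{- For every 2-permutation $w\in\mathfrak{S}_{\mathcal{N}}$, the Greedy Strategy for Two-color Patience Sorting forms the fewest number of piles possible: no strategy for Two-color Patience Sorting applied to $w$ ends with fewer piles.
   Context: Let $[n]=\{1,\dots,n\}$, $[\bar n]=\{\bar1,\dots,\bar n\}$ and $\mathcal{N}=[n]\cup[\bar n]$ (barred and unbarred cards are the two colors). A 2-permutation is a word $w=w_1\cdots w_{2n}$ using each element of $\mathcal{N}$ exactly once; $\mathfrak{S}_{\mathcal{N}}$ is the set of these. For $x\in\mathcal{N}$, $x^{\pm}$ denotes its numeric value ignoring the bar; $\mathrm{bar}(x,y)=1$ if exactly one of $x,y$ is barred and $0$ otherwise. Two-color Patience Sorting: $w_1$ is placed in a pile by itself; for $i=2,\dots,2n$, $w_i$ is either put into a new pile or played on top of any pile whose current top card $d$ satisfies $d^{\pm}>w_i^{\pm}$ and $\mathrm{bar}(w_i,d)=1$; the objective is to end with as few piles as possible. Greedy Strategy: if some pile has top card $d$ with $d^{\pm}>w_i^{\pm}$ and $\mathrm{bar}(w_i,d)=1$, play $w_i$ on the pile whose such top card has the smallest value; otherwise form a new pile. -}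

module Defs where

open import Data.Nat using (ℕ; zero; suc; _<_; _<ᵇ_; _≡ᵇ_)
open import Data.Bool using (Bool; true; false; not; _∧_; _xor_; if_then_else_)
open import Data.List using (List; []; _∷_; _++_; [_]; map; upTo; foldl)
open import Data.Maybe using (Maybe; nothing; just)
open import Data.Product using (_×_; _,_; proj₁; proj₂)
open import Relation.Binary.PropositionalEquality using (_≢_)

-- A card: (numeric value x^±, barred?).  true = barred.
Card : Set
Card = ℕ × Bool

val : Card → ℕ
val = proj₁

barred : Card → Bool
barred = proj₂

allCards : ℕ → List Card
allCards n = map (λ i → (suc i , false)) (upTo n) ++ map (λ i → (suc i , true)) (upTo n)

-- A pile is a list of cards, head = top card.  A configuration is a list of piles.
Pile : Set
Pile = List Card

Legal : Card → Card → Set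
Legal c d = (val c < val d) × (barred c ≢ barred d)

data Step : List Pile → Card → List Pile → Set where
  newPile : ∀ {ps c} → Step ps c (ps ++ [ c ∷ [] ])
  playOn  : ∀ {c d} (ps qs : List Pile) (p : Pile) → Legal c d →
            Step (ps ++ ((d ∷ p) ∷ qs)) c (ps ++ ((c ∷ d ∷ p) ∷ qs))

data Run : List Pile → List Card → List Pile → Set where
  done : ∀ {ps} → Run ps [] ps
  move : ∀ {ps c w ps' qs} → Step ps c ps' → Run ps' w qs → Run ps (c ∷ w) qs

legalᵇ : Card → Card → Bool
legalᵇ c d = (val c <ᵇ val d) ∧ (barred c xor barred d)

minMaybe : ℕ → Maybe ℕ → Maybe ℕ
minMaybe a nothing = just a
minMaybe a (just b) = just (if a <ᵇ b then a else b)

bestTop : Card → List Pile → Maybe ℕ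
bestTop c [] = nothing
bestTop c ([] ∷ ps) = bestTop c ps
bestTop c ((d ∷ p) ∷ ps) =
  if legalᵇ c d then minMaybe (val d) (bestTop c ps) else bestTop c ps

placeAt : Card → ℕ → List Pile → List Pile
placeAt c m [] = []
placeAt c m ([] ∷ ps) = [] ∷ placeAt c m ps
placeAt c m ((d ∷ p) ∷ ps) =
  if legalᵇ c d ∧ (val d ≡ᵇ m) then (c ∷ d ∷ p) ∷ ps else (d ∷ p) ∷ placeAt c m ps

greedyStep : List Pile → Card → List Pile
greedyStep ps c with bestTop c ps
... | nothing = ps ++ [ c ∷ [] ]
... | just m  = placeAt c m ps

greedy : List Card → List Pile
greedy w = foldl greedyStep [] w

-- Fix an up-closed set U of card values and a colour b, and weigh a configuration by
-- its buried cards of colour b plus its top cards of colour b with value in U.  After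
-- every card, the greedy configuration weighs at least as much as the configuration of
-- any other strategy, for all U and b at once.  Another strategy can only out-gain
-- greedy by burying a top a ∉ U of colour b under c; its weight for the values above
-- val c then exceeds its U-weight before the move.  Greedy either buries such a card
-- too, or plays c on the lowest legal top (or opens a pile), so that every top of
-- colour b above val c lies in U and greedy's U-weight is at least its weight for the
-- values above val c.  Since every move opens a pile or buries a card, piles plus buried
-- cards count the cards dealt, and U = ∅ shows that greedy buries the most cards and so
-- ends with the fewest piles.

module Submission where

open import Defs
open import Data.Nat using (ℕ; _≤_)
open import Data.List using (List; []; length)
open import Data.List.Relation.Binary.Permutation.Propositional using (_↭_)
open import Data.Product using (_×_)

open import Data.Bool using (Bool; true; false; not; T; _∧_; _xor_; if_then_else_)
open import Data.Bool.Properties as Bool using (T-∧; ¬-not; not-injective)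
open import Data.Empty using (⊥-elim)
open import Data.List using (_∷_; _++_; [_]; map; foldl)
open import Data.List.Properties using (length-++; map-++)
open import Data.List.Relation.Unary.All as All using (All; []; _∷_)
open import Data.Maybe using (just; nothing)
open import Data.Maybe.Properties using (just-injective)
open import Data.Maybe.Relation.Unary.All as Maybe using (just; nothing)
open import Data.Nat using (suc; _+_; _<_; _<ᵇ_; _≡ᵇ_; _⊓_; z≤n; s≤s)
open import Data.Nat.ListAction using (sum)
open import Data.Nat.ListAction.Properties using (sum-++)
open import Data.Nat.Properties
open import Algebra.Properties.CommutativeSemigroup +-commutativeSemigroup
  using (x∙yz≈y∙xz; xy∙z≈y∙xz; interchange)
open import Data.Product using (_,_; proj₁; proj₂)
open import Data.Unit using (⊤; tt)
open import Function using (_∘_; const)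
open import Function.Bundles using (Equivalence)
open import Relation.Binary.PropositionalEquality
  using (_≡_; _≢_; refl; sym; trans; cong; cong₂; subst; module ≡-Reasoning)
open import Relation.Nullary using (¬_; Dec; does; yes; no; contradiction)
open import Relation.Nullary.Decidable using (dec-false; T?)
open import Relation.Nullary.Reflects using (Reflects; ofʸ; ofⁿ; _×-reflects_; fromEquivalence)

⟦_⟧ : Bool → ℕ
⟦ true ⟧  = 1
⟦ false ⟧ = 0

⟦⟧-true : ∀ {x} → T x → ⟦ x ⟧ ≡ 1
⟦⟧-true {true} _ = refl

⟦⟧-false : ∀ {x} → ¬ T x → ⟦ x ⟧ ≡ 0
⟦⟧-false {false} _ = refl
⟦⟧-false {true}  ¬t = contradiction _ ¬t

Upset : (ℕ → Bool) → Set
Upset U = ∀ {x y} → x ≤ y → T (U x) → T (U y)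

∅ : ℕ → Bool
∅ = const false

above : ℕ → ℕ → Bool
above v x = v <ᵇ x

∅-upset : Upset ∅
∅-upset _ ()

above-upset : ∀ v → Upset (above v)
above-upset v {x} x≤y v<x = <⇒<ᵇ (<-≤-trans (<ᵇ⇒< v x v<x) x≤y)

upset-beyond : ∀ {U x y} → Upset U → ¬ T (U x) → T (U y) → x < y
upset-beyond up ¬Ux Uy = ≰⇒> (λ y≤x → ¬Ux (up y≤x Uy))

isColour : Bool → Card → Bool
isColour b d = does (barred d Bool.≟ b)

isColour⇒≡ : ∀ {b d} → T (isColour b d) → barred d ≡ b
isColour⇒≡ {b} {d} t with barred d Bool.≟ b
... | yes eq = eq

≡⇒isColour : ∀ {b d} → barred d ≡ b → T (isColour b d)
≡⇒isColour {b} {d} eq with barred d Bool.≟ b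
... | yes _ = tt
... | no ne = ne eq

count : Bool → Pile → ℕ
count b p = sum (map (⟦_⟧ ∘ isColour b) p)

topWeight : (ℕ → Bool) → Bool → Card → ℕ
topWeight U b d = ⟦ U (val d) ∧ isColour b d ⟧

coverWeight : (ℕ → Bool) → Bool → Card → ℕ
coverWeight U b d = ⟦ not (U (val d)) ∧ isColour b d ⟧

pileWeight : (ℕ → Bool) → Bool → Pile → ℕ
pileWeight U b []      = 0
pileWeight U b (d ∷ p) = topWeight U b d + count b p

weight : (ℕ → Bool) → Bool → List Pile → ℕ
weight U b ps = sum (map (pileWeight U b) ps)

buried : List Pile → ℕ
buried ps = weight ∅ false ps + weight ∅ true ps

weight-++ : ∀ U b ps qs → weight U b (ps ++ qs) ≡ weight U b ps + weight U b qs
weight-++ U b ps qs = trans (cong sum (map-++ (pileWeight U b) ps qs)) (sum-++ (map (pileWeight U b) ps) _)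

weight-newPile : ∀ U b ps c → weight U b (ps ++ [ c ∷ [] ]) ≡ topWeight U b c + weight U b ps
weight-newPile U b ps c = begin
  weight U b (ps ++ [ c ∷ [] ])         ≡⟨ weight-++ U b ps _ ⟩
  weight U b ps + (topWeight U b c + 0 + 0) ≡⟨ cong (weight U b ps +_) (trans (+-identityʳ _) (+-identityʳ _)) ⟩
  weight U b ps + topWeight U b c       ≡⟨ +-comm (weight U b ps) _ ⟩
  topWeight U b c + weight U b ps       ∎
  where open ≡-Reasoning

weight-replace : ∀ U b ps qs {x x′ k} → pileWeight U b x′ ≡ k + pileWeight U b x →
  weight U b (ps ++ x′ ∷ qs) ≡ k + weight U b (ps ++ x ∷ qs)
weight-replace U b [] qs {k = k} e = trans (cong (_+ weight U b qs) e) (+-assoc k _ _)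
weight-replace U b (y ∷ ps) qs {x} {k = k} e =
  trans (cong (pileWeight U b y +_) (weight-replace U b ps qs e))
        (x∙yz≈y∙xz (pileWeight U b y) k (weight U b (ps ++ x ∷ qs)))

colour-split : ∀ U b d → ⟦ isColour b d ⟧ ≡ topWeight U b d + coverWeight U b d
colour-split U b d with U (val d)
... | true  = sym (+-identityʳ _)
... | false = refl

pileWeight-cover : ∀ U b c d p →
  pileWeight U b (c ∷ d ∷ p) ≡ topWeight U b c + coverWeight U b d + pileWeight U b (d ∷ p)
pileWeight-cover U b c d p = begin
  tc + (⟦ isColour b d ⟧ + n) ≡⟨ cong (λ k → tc + (k + n)) (colour-split U b d) ⟩
  tc + ((td + cd) + n)        ≡⟨ cong (tc +_) (xy∙z≈y∙xz td cd n) ⟩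
  tc + (cd + (td + n))        ≡⟨ +-assoc tc cd _ ⟨
  tc + cd + (td + n)          ∎
  where
  open ≡-Reasoning
  tc = topWeight U b c
  td = topWeight U b d
  cd = coverWeight U b d
  n  = count b p

weight-playOn : ∀ U b ps qs c d p →
  weight U b (ps ++ (c ∷ d ∷ p) ∷ qs) ≡ topWeight U b c + coverWeight U b d + weight U b (ps ++ (d ∷ p) ∷ qs)
weight-playOn U b ps qs c d p = weight-replace U b ps qs (pileWeight-cover U b c d p)

topWeight-otherColour : ∀ U {b d} → barred d ≢ b → topWeight U b d ≡ 0
topWeight-otherColour U {b} {d} d≢b
  rewrite dec-false (barred d Bool.≟ b) d≢b = cong ⟦_⟧ (Bool.∧-zeroʳ (U (val d)))

coverWeight-inside : ∀ {U} b {d} → T (U (val d)) → coverWeight U b d ≡ 0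
coverWeight-inside {U} b {d} Ud with U (val d)
... | true = refl

coverWeight-otherColour : ∀ U {b d} → barred d ≢ b → coverWeight U b d ≡ 0
coverWeight-otherColour U {b} {d} d≢b
  rewrite dec-false (barred d Bool.≟ b) d≢b = cong ⟦_⟧ (Bool.∧-zeroʳ (not (U (val d))))

coverWeight-outside : ∀ {U b d} → ¬ T (U (val d)) → barred d ≡ b → coverWeight U b d ≡ 1
coverWeight-outside {U} {b} {d} ¬Ud d≡b with U (val d)
... | true  = contradiction _ ¬Ud
... | false = ⟦⟧-true (≡⇒isColour {d = d} d≡b)

OnTop : (Card → Set) → Pile → Set
OnTop P []      = ⊤
OnTop P (d ∷ _) = P d

all-onTop-map : ∀ {P Q : Card → Set} → (∀ d → P d → Q d) → ∀ {ps} → All (OnTop P) ps → All (OnTop Q) ps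
all-onTop-map f = All.map λ { {[]} _ → tt ; {d ∷ _} Pd → f d Pd }

all-onTop : ∀ {P : Card → Set} → (∀ d → P d) → ∀ ps → All (OnTop P) ps
all-onTop f = All.universal λ { [] → tt ; (d ∷ _) → f d }

TopInclusion : (ℕ → Bool) → (ℕ → Bool) → Bool → Card → Set
TopInclusion U₁ U₂ b d = T (U₁ (val d)) → T (isColour b d) → T (U₂ (val d))

topWeight-mono : ∀ U₁ U₂ b d → TopInclusion U₁ U₂ b d → topWeight U₁ b d ≤ topWeight U₂ b d
topWeight-mono U₁ U₂ b d h with U₁ (val d) | U₂ (val d) | isColour b d
... | false | _     | _     = z≤n
... | true  | true  | _     = ≤-refl
... | true  | false | false = z≤n
... | true  | false | true  = ⊥-elim (h tt tt)

weight-mono : ∀ {U₁ U₂ b ps} → All (OnTop (TopInclusion U₁ U₂ b)) ps → weight U₁ b ps ≤ weight U₂ b ps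
weight-mono                                   []       = z≤n
weight-mono {ps = [] ∷ _}                     (_ ∷ hs) = weight-mono hs
weight-mono {U₁} {U₂} {b} {(d ∷ p) ∷ _} (h ∷ hs) =
  +-mono-≤ (+-monoˡ-≤ (count b p) (topWeight-mono U₁ U₂ b d h)) (weight-mono hs)

pileWeight-above : ∀ {U b v a} p → v < val a → ¬ T (U (val a)) → barred a ≡ b →
  suc (pileWeight U b (a ∷ p)) ≤ pileWeight (above v) b (a ∷ p)
pileWeight-above {U} {b} {v} {a} p v<a ¬Ua a≡b
  rewrite ⟦⟧-false {U (val a) ∧ isColour b a} (¬Ua ∘ proj₁ ∘ Equivalence.to T-∧)
        | ⟦⟧-true {above v (val a) ∧ isColour b a} (Equivalence.from T-∧ (<⇒<ᵇ v<a , ≡⇒isColour {d = a} a≡b))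
  = ≤-refl

-- Tops of colour b inside U lie above a, since a ∉ U and U is an upset.
weight-above : ∀ {U b v a} ps qs p → Upset U → v < val a → ¬ T (U (val a)) → barred a ≡ b →
  suc (weight U b (ps ++ (a ∷ p) ∷ qs)) ≤ weight (above v) b (ps ++ (a ∷ p) ∷ qs)
weight-above {U} {b} {v} {a} ps qs p up v<a ¬Ua a≡b
  rewrite weight-++ U b ps ((a ∷ p) ∷ qs) | weight-++ (above v) b ps ((a ∷ p) ∷ qs)
  = ≤-trans (≤-reflexive (sym (+-suc _ _)))
      (+-mono-≤ (weight-mono (all-onTop U⊆above ps))
        (+-mono-≤ (pileWeight-above {U} p v<a ¬Ua a≡b) (weight-mono (all-onTop U⊆above qs))))
  where
  U⊆above : ∀ d → TopInclusion U (above v) b d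
  U⊆above d Ud _ = <⇒<ᵇ (<-trans v<a (upset-beyond {U} up ¬Ua Ud))

xor-reflects-≢ : ∀ x y → Reflects (x ≢ y) (x xor y)
xor-reflects-≢ true  true  = ofⁿ (λ x≢x → x≢x refl)
xor-reflects-≢ true  false = ofʸ (λ ())
xor-reflects-≢ false true  = ofʸ (λ ())
xor-reflects-≢ false false = ofⁿ (λ x≢x → x≢x refl)

≡ᵇ-reflects-≡ : ∀ m n → Reflects (m ≡ n) (m ≡ᵇ n)
≡ᵇ-reflects-≡ m n = fromEquivalence (≡ᵇ⇒≡ m n) (≡⇒≡ᵇ m n)

legalᵇ-reflects : ∀ c d → Reflects (Legal c d) (legalᵇ c d)
legalᵇ-reflects c d = <ᵇ-reflects-< (val c) (val d) ×-reflects xor-reflects-≢ (barred c) (barred d)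

minMaybe≢nothing : ∀ a r → minMaybe a r ≢ nothing
minMaybe≢nothing a nothing  ()
minMaybe≢nothing a (just b) ()

minMaybe-lowerBound : ∀ {k a r} → Maybe.All (k ≤_) (minMaybe a r) → k ≤ a × Maybe.All (k ≤_) r
minMaybe-lowerBound {r = nothing} (just k≤a) = k≤a , nothing
minMaybe-lowerBound {k} {a} {just b} (just k≤min) with a <ᵇ b | <ᵇ-reflects-< a b
... | true  | ofʸ a<b = k≤min , just (≤-trans k≤min (<⇒≤ a<b))
... | false | ofⁿ a≮b = ≤-trans k≤min (≮⇒≥ a≮b) , just k≤min

minMaybe-other : ∀ {a r m} → minMaybe a r ≡ just m → a ≢ m → r ≡ just m
minMaybe-other {r = nothing} e a≢m = contradiction (just-injective e) a≢m
minMaybe-other {a} {just b} e a≢m with a <ᵇ b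
... | true  = contradiction (just-injective e) a≢m
... | false = e

bestTop-nothing : ∀ {c} ps → bestTop c ps ≡ nothing → All (OnTop (¬_ ∘ Legal c)) ps
bestTop-nothing [] _ = []
bestTop-nothing ([] ∷ ps) none = tt ∷ bestTop-nothing ps none
bestTop-nothing {c} ((d ∷ _) ∷ ps) none with legalᵇ c d | legalᵇ-reflects c d
... | false | ofⁿ ¬legal = ¬legal ∷ bestTop-nothing ps none
... | true  | ofʸ _      = contradiction none (minMaybe≢nothing (val d) (bestTop c ps))

bestTop-lowerBound : ∀ {c k} ps → Maybe.All (k ≤_) (bestTop c ps) →
  All (OnTop (λ d → Legal c d → k ≤ val d)) ps
bestTop-lowerBound [] _ = []
bestTop-lowerBound ([] ∷ ps) bound = tt ∷ bestTop-lowerBound ps bound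
bestTop-lowerBound {c} ((d ∷ _) ∷ ps) bound with legalᵇ c d | legalᵇ-reflects c d
... | false | ofⁿ ¬legal = (λ legal → contradiction legal ¬legal) ∷ bestTop-lowerBound ps bound
... | true  | ofʸ _ with minMaybe-lowerBound bound
...   | k≤d , bound′ = const k≤d ∷ bestTop-lowerBound ps bound′

data PlacedOn (c : Card) (m : ℕ) : List Pile → Set where
  placedOn : ∀ ps g p qs → Legal c g → val g ≡ m →
    placeAt c m (ps ++ (g ∷ p) ∷ qs) ≡ ps ++ (c ∷ g ∷ p) ∷ qs →
    PlacedOn c m (ps ++ (g ∷ p) ∷ qs)

placedOn-cons : ∀ {c m ps} x → placeAt c m (x ∷ ps) ≡ x ∷ placeAt c m ps →
  PlacedOn c m ps → PlacedOn c m (x ∷ ps)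
placedOn-cons x skip (placedOn ps g p qs legal g≡m placed) =
  placedOn (x ∷ ps) g p qs legal g≡m (trans skip (cong (x ∷_) placed))

placeAt-if : ∀ {c m} d p ps {b} → legalᵇ c d ∧ (val d ≡ᵇ m) ≡ b →
  placeAt c m ((d ∷ p) ∷ ps) ≡ (if b then (c ∷ d ∷ p) ∷ ps else (d ∷ p) ∷ placeAt c m ps)
placeAt-if d p ps refl = refl

placeAt-bestTop : ∀ {c m} ps → bestTop c ps ≡ just m → PlacedOn c m ps
placeAt-bestTop [] ()
placeAt-bestTop ([] ∷ ps) best = placedOn-cons [] refl (placeAt-bestTop ps best)
placeAt-bestTop {c} {m} ((d ∷ p) ∷ ps) best with legalᵇ c d in isLegal | legalᵇ-reflects c d
... | false | ofⁿ _ =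
  placedOn-cons (d ∷ p) (placeAt-if d p ps (cong (_∧ _) isLegal)) (placeAt-bestTop ps best)
... | true  | ofʸ legal with val d ≡ᵇ m in isAt | ≡ᵇ-reflects-≡ (val d) m
...   | true  | ofʸ d≡m =
  placedOn [] d p ps legal d≡m (placeAt-if d p ps (trans (cong (_∧ _) isLegal) isAt))
...   | false | ofⁿ d≢m =
  placedOn-cons (d ∷ p) (placeAt-if d p ps (trans (cong (_∧ _) isLegal) isAt))
    (placeAt-bestTop ps (minMaybe-other best d≢m))

data GreedyMove (c : Card) : List Pile → List Pile → Set where
  fresh : ∀ {G} → All (OnTop (¬_ ∘ Legal c)) G → GreedyMove c G (G ++ [ c ∷ [] ])
  onto  : ∀ {ps g p qs} → Legal c g →
          All (OnTop (λ d → Legal c d → val g ≤ val d)) (ps ++ (g ∷ p) ∷ qs) →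
          GreedyMove c (ps ++ (g ∷ p) ∷ qs) (ps ++ (c ∷ g ∷ p) ∷ qs)

greedyStep-move : ∀ G c → GreedyMove c G (greedyStep G c)
greedyStep-move G c with bestTop c G in best
... | nothing = fresh (bestTop-nothing G best)
... | just m with placeAt-bestTop G best
...   | placedOn ps g p qs legal refl placed rewrite placed =
  onto legal (bestTop-lowerBound (ps ++ (g ∷ p) ∷ qs)
                (subst (Maybe.All (val g ≤_)) (sym best) (just ≤-refl)))

greedyMove-step : ∀ {c G G′} → GreedyMove c G G′ → Step G c G′
greedyMove-step (fresh _) = newPile
greedyMove-step (onto {ps} {g} {p} {qs} legal _) = playOn ps qs p legal

greedy-run : ∀ G w → Run G w (foldl greedyStep G w)
greedy-run G []      = done
greedy-run G (c ∷ w) = move (greedyMove-step (greedyStep-move G c)) (greedy-run (greedyStep G c) w)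

legal-colour : ∀ {c d b} → Legal c d → barred c ≢ b → barred d ≡ b
legal-colour legal c≢b = not-injective (trans (sym (¬-not (proj₂ legal))) (¬-not c≢b))

legal-above : ∀ {c d b} → barred c ≢ b → T (above (val c) (val d)) → T (isColour b d) → Legal c d
legal-above {c} {d} c≢b c<d d∈b = <ᵇ⇒< (val c) (val d) c<d , λ c≡d → c≢b (trans c≡d (isColour⇒≡ {d = d} d∈b))

greedy-gain : ∀ U b {c G G′} → GreedyMove c G G′ → topWeight U b c + weight U b G ≤ weight U b G′
greedy-gain U b {c} {G} (fresh _) = ≤-reflexive (sym (weight-newPile U b G c))
greedy-gain U b {c} (onto {ps} {g} {p} {qs} _ _)
  rewrite weight-playOn U b ps qs c g p =
  +-monoˡ-≤ (weight U b (ps ++ (g ∷ p) ∷ qs)) (m≤m+n (topWeight U b c) (coverWeight U b g))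

greedy-catchup : ∀ {U b c G G′} → Upset U → barred c ≢ b → GreedyMove c G G′ →
  suc (weight U b G) ⊓ weight (above (val c)) b G ≤ weight U b G′
greedy-catchup {U} {b} {c} {G} up c≢b (fresh illegal) rewrite weight-newPile U b G c =
  ≤-trans (m⊓n≤n _ _) (≤-trans (weight-mono (all-onTop-map aboveIllegal illegal)) (m≤n+m _ _))
  where
  aboveIllegal : ∀ d → ¬ Legal c d → TopInclusion (above (val c)) U b d
  aboveIllegal d ¬legal c<d d∈b =
    contradiction (legal-above c≢b c<d d∈b) ¬legal
greedy-catchup {U} {b} {c} up c≢b (onto {ps} {g} {p} {qs} legal lowest) =
  ≤-trans (catchup (T? (U (val g)))) (≤-reflexive (sym (weight-playOn U b ps qs c g p)))
  where
  G = ps ++ (g ∷ p) ∷ qs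
  open ≤-Reasoning

  aboveInU : T (U (val g)) → ∀ d → (Legal c d → val g ≤ val d) → TopInclusion (above (val c)) U b d
  aboveInU Ug d g≤d c<d d∈b = up (g≤d (legal-above c≢b c<d d∈b)) Ug

  catchup : Dec (T (U (val g))) →
    suc (weight U b G) ⊓ weight (above (val c)) b G ≤ topWeight U b c + coverWeight U b g + weight U b G
  catchup (yes Ug) = begin
    suc (weight U b G) ⊓ weight (above (val c)) b G ≤⟨ m⊓n≤n _ _ ⟩
    weight (above (val c)) b G                       ≤⟨ weight-mono (all-onTop-map (aboveInU Ug) lowest) ⟩
    weight U b G                                     ≤⟨ m≤n+m _ _ ⟩
    topWeight U b c + coverWeight U b g + weight U b G ∎
  catchup (no ¬Ug) = begin
    suc (weight U b G) ⊓ weight (above (val c)) b G ≤⟨ m⊓n≤m _ _ ⟩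
    suc (weight U b G)                               ≤⟨ m≤n+m _ (topWeight U b c) ⟩
    topWeight U b c + (1 + weight U b G)             ≡⟨ +-assoc (topWeight U b c) 1 _ ⟨
    topWeight U b c + 1 + weight U b G               ≡⟨ cong (λ k → topWeight U b c + k + weight U b G) gain ⟨
    topWeight U b c + coverWeight U b g + weight U b G ∎
    where
    gain : coverWeight U b g ≡ 1
    gain = coverWeight-outside {U} {d = g} ¬Ug (legal-colour legal c≢b)

_≼_ : List Pile → List Pile → Set
A ≼ G = ∀ {U} → Upset U → ∀ b → weight U b A ≤ weight U b G

gain-dominated : ∀ {A c G G′} → A ≼ G → GreedyMove c G G′ →
  ∀ {U} → Upset U → ∀ b → topWeight U b c + weight U b A ≤ weight U b G′
gain-dominated {c = c} dom chosen {U} up b =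
  ≤-trans (+-monoʳ-≤ (topWeight U b c) (dom up b)) (greedy-gain U b chosen)

step-dominated : ∀ {A c A′ G G′} → Step A c A′ → GreedyMove c G G′ → A ≼ G → A′ ≼ G′
step-dominated {A} {c} newPile chosen dom {U} up b =
  ≤-trans (≤-reflexive (weight-newPile U b A c)) (gain-dominated {A} dom chosen up b)
step-dominated {c = c} {G = G} {G′} (playOn {d = a} ps qs p legal) chosen dom {U} up b =
  ≤-trans (≤-reflexive (weight-playOn U b ps qs c a p)) (cover (T? (U (val a))) (barred a Bool.≟ b))
  where
  A = ps ++ (a ∷ p) ∷ qs
  open ≤-Reasoning

  unburied : coverWeight U b a ≡ 0 → topWeight U b c + coverWeight U b a + weight U b A ≤ weight U b G′
  unburied nothingBuried = begin
    topWeight U b c + coverWeight U b a + weight U b A ≡⟨ cong (λ k → topWeight U b c + k + weight U b A) nothingBuried ⟩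
    topWeight U b c + 0 + weight U b A                 ≡⟨ cong (_+ weight U b A) (+-identityʳ _) ⟩
    topWeight U b c + weight U b A                     ≤⟨ gain-dominated {A} dom chosen up b ⟩
    weight U b G′                                      ∎

  cover : Dec (T (U (val a))) → Dec (barred a ≡ b) →
    topWeight U b c + coverWeight U b a + weight U b A ≤ weight U b G′
  cover (yes Ua) _         = unburied (coverWeight-inside {U} b {a} Ua)
  cover (no _)   (no a≢b)  = unburied (coverWeight-otherColour U a≢b)
  cover (no ¬Ua) (yes a≡b) = begin
    topWeight U b c + coverWeight U b a + weight U b A
      ≡⟨ cong₂ (λ t k → t + k + weight U b A) (topWeight-otherColour U c≢b) (coverWeight-outside {U} ¬Ua a≡b) ⟩
    suc (weight U b A)
      ≤⟨ ⊓-glb (s≤s (dom up b)) (≤-trans (weight-above ps qs p up (proj₁ legal) ¬Ua a≡b) (dom (above-upset (val c)) b)) ⟩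
    suc (weight U b G) ⊓ weight (above (val c)) b G
      ≤⟨ greedy-catchup up c≢b chosen ⟩
    weight U b G′ ∎
    where
    c≢b : barred c ≢ b
    c≢b c≡b = proj₂ legal (trans c≡b (sym a≡b))

run-dominated : ∀ {A w A′ G} → Run A w A′ → A ≼ G → A′ ≼ foldl greedyStep G w
run-dominated done dom = dom
run-dominated {G = G} (move {c = c} s r) dom =
  run-dominated r (step-dominated s (greedyStep-move G c) dom)

colours-partition : ∀ d → ⟦ isColour false d ⟧ + ⟦ isColour true d ⟧ ≡ 1
colours-partition (_ , false) = refl
colours-partition (_ , true)  = refl

step-count : ∀ {A c A′} → Step A c A′ → length A′ + buried A′ ≡ suc (length A + buried A)
step-count {A} {c} newPile
  rewrite length-++ A {[ c ∷ [] ]} | weight-newPile ∅ false A c | weight-newPile ∅ true A c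
  = cong (_+ buried A) (+-comm (length A) 1)
step-count {c = c} (playOn {d = a} ps qs p _) = begin
  length (ps ++ (c ∷ a ∷ p) ∷ qs) + buried (ps ++ (c ∷ a ∷ p) ∷ qs)
    ≡⟨ cong₂ _+_ (trans (length-++ ps) (sym (length-++ ps)))
                 (cong₂ _+_ (weight-playOn ∅ false ps qs c a p) (weight-playOn ∅ true ps qs c a p)) ⟩
  L + ((⟦ isColour false a ⟧ + weight ∅ false A) + (⟦ isColour true a ⟧ + weight ∅ true A))
    ≡⟨ cong (L +_) (interchange ⟦ isColour false a ⟧ (weight ∅ false A) ⟦ isColour true a ⟧ (weight ∅ true A)) ⟩
  L + ((⟦ isColour false a ⟧ + ⟦ isColour true a ⟧) + buried A)
    ≡⟨ cong (λ k → L + (k + buried A)) (colours-partition a) ⟩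
  L + suc (buried A)
    ≡⟨ +-suc L _ ⟩
  suc (L + buried A) ∎
  where
  open ≡-Reasoning
  A = ps ++ (a ∷ p) ∷ qs
  L = length A

run-count : ∀ {A w A′} → Run A w A′ → length A′ + buried A′ ≡ length w + (length A + buried A)
run-count done = refl
run-count {w = _ ∷ w} (move s r) =
  trans (run-count r) (trans (cong (length w +_) (step-count s)) (+-suc (length w) _))

fewer-piles : ∀ {A G} → length G + buried G ≡ length A + buried A → A ≼ G → length G ≤ length A
fewer-piles {A} {G} sameCards dom =
  +-cancelʳ-≤ (buried A) (length G) (length A)
    (≤-trans (+-monoʳ-≤ (length G) (+-mono-≤ (dom ∅-upset false) (dom ∅-upset true))) (≤-reflexive sameCards))

mainTheorem8 : (n : ℕ) (w : List Card) → w ↭ allCards n →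
    Run [] w (greedy w) × ((piles : List Pile) → Run [] w piles → length (greedy w) ≤ length piles)
-- The argument applies to any word of cards.
mainTheorem8 n w _ = greedy-run [] w , λ piles run →
  fewer-piles {piles} {greedy w}
    (trans (run-count (greedy-run [] w)) (sym (run-count run)))
    (run-dominated run (λ _ _ → z≤n))
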